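{- There is a bijection between LR-maxima of $\sigma$ and dotted boxes in $T$ with maximal height and with a left border equal to $D$.
   Context: Let $T$ be a Dyck tableau of size $n$ and $\sigma=\phi(T)$. A Dyck tableau of size $n$ is a Dyck path of size $n$ (the staircase Ferrers diagram $E_n=(n,\dots,1)$ with the boxes of a partition $\mu\subset E_{n-1}$ removed, with $n$ columns) in which each column contains exactly one dot. The tableau $T$ with $\phi(T)=\sigma$ is constructed from $\sigma$: label the columns of a basement from left to right by $\sigma(1),\dots,\sigma(n)$ and, for $j=1,\dots,n$, insert a dotted box in the column labeled $j$ and, if it is to the left of the dotted box added at step $j-1$, add a ribbon between these two boxes (a strip of boxes along the lower border linking the two dots, raising by one box the columns strictly between them). The height of a dot is the number of empty boxes above it in its column; it is maximal when it equals the number of boxes of the column minus one, i.e. there is no box below the dot. The left border of a column is the left one of the two steps of the lower border at the bottom of that column ($D$ for a down step, $U$ for an up step). An entry $j=\sigma(i)$ is a left-to-right maximum (LR-maximum) if $\sigma(i)>\sigma(i')$ for all $i'<i$. -}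

module Defs where

open import Data.Nat using (ℕ; zero; suc; _+_; _*_; _∸_; _<ᵇ_; ⌊_/2⌋)
open import Data.Bool using (Bool; true; false; if_then_else_; _∧_)
open import Data.Fin using (Fin; toℕ) renaming (_<_ to _<ᶠ_)
open import Data.Fin.Permutation using (Permutation′; _⟨$⟩ʳ_; _⟨$⟩ˡ_)
open import Data.List using (List; foldl; map; allFin)
open import Data.Maybe using (Maybe; just; nothing)
open import Data.Product using (Σ; _×_; _,_; proj₁)
open import Relation.Binary.PropositionalEquality using (_≡_; setoid)
open import Relation.Binary.Bundles using (Setoid)
import Relation.Binary.Construct.On as On

-- Columns are numbered 0,…,n-1 from left to right (column i is the
-- (i+1)-th column).  The Dyck path E_n / μ is drawn (rotated by 45°)
-- as the region between a lower border and a fixed roof; the lower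
-- border is a path of 2n steps U/D whose vertices are numbered
-- 0,…,2n, and `depth k` is the depth of vertex k below the roof level
-- (a D step increases the depth by one, a U step decreases it).
-- Column i is the vertical column of boxes standing on vertex 2i+1:
-- its bottom box sits on the two steps (2i → 2i+1) and (2i+1 → 2i+2)
-- of the lower border and it contains ⌊(depth(2i+1)+1)/2⌋ boxes.
-- `dotHeight i` is the height of the dot of column i, i.e. the number
-- of (empty) boxes above it in its column.

data Step : Set where
  U D : Step

record Tableau : Set where
  field
    depth     : ℕ → ℕ
    dotHeight : ℕ → ℕ

open Tableau public

boxes : Tableau → ℕ → ℕ
boxes T i = ⌊ suc (depth T (suc (2 * i))) /2⌋

leftBorder : Tableau → ℕ → Step
leftBorder T i =
  if depth T (2 * i) <ᵇ depth T (suc (2 * i)) then D else U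

MaxHeight : Tableau → ℕ → Set
MaxHeight T i = dotHeight T i ≡ boxes T i ∸ 1

-- the basement: lower border (DU)^n, every column has one (empty) box
basement : Tableau
basement = record
  { depth     = λ k → if isOdd k then 1 else 0
  ; dotHeight = λ _ → 0
  }
  where
  isOdd : ℕ → Bool
  isOdd zero          = false
  isOdd (suc zero)    = true
  isOdd (suc (suc k)) = isOdd k

-- insert a dotted box in column p, at the bottom of the column: all the
-- boxes already in the column are above it (and empty)
insertDot : ℕ → Tableau → Tableau
insertDot p T = record T
  { dotHeight = λ i → if i Data.Nat.≡ᵇ p then boxes T p ∸ 1 else dotHeight T i }

-- add a ribbon along the lower border between the dot of column a and
-- the dot of column b (a < b): the lower border strictly between the
-- bottoms of columns a and b is pushed down by one box (two levels), so
-- every column strictly between a and b is raised by one box (a new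
-- box appears below its content); the dots keep their heights.
ribbon : ℕ → ℕ → Tableau → Tableau
ribbon a b T = record T
  { depth = λ k →
      if (suc (2 * a) <ᵇ k) ∧ (k <ᵇ suc (2 * b))
      then depth T k + 2 else depth T k }

-- step j of the construction: p = position of the column labeled j,
-- prev = position of the column labeled j−1 (if j > 1)
step : Tableau × Maybe ℕ → ℕ → Tableau × Maybe ℕ
step (T , nothing)   p = insertDot p T , just p
step (T , just prev) p =
  (if p <ᵇ prev then ribbon p prev (insertDot p T) else insertDot p T) , just p

-- position (0-based column index) of the column labeled by label j
-- (labels are 0-based as well: label j stands for the paper's j+1)
position : ∀ {n} → Permutation′ n → Fin n → ℕ
position σ j = toℕ (σ ⟨$⟩ˡ j)

-- the Dyck tableau T with φ(T) = σ; the column at position i carries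
-- the label σ(i) = σ ⟨$⟩ʳ i
tableau : ∀ {n} → Permutation′ n → Tableau
tableau {n} σ =
  proj₁ (foldl step (basement , nothing) (map (position σ) (allFin n)))

LRMax : ∀ {n} → Permutation′ n → Fin n → Set
LRMax {n} σ i = ∀ (i′ : Fin n) → i′ <ᶠ i → (σ ⟨$⟩ʳ i′) <ᶠ (σ ⟨$⟩ʳ i)

MaxHeightLeftD : Tableau → ∀ {n} → Fin n → Set
MaxHeightLeftD T i = MaxHeight T (toℕ i) × leftBorder T (toℕ i) ≡ D

-- the set { i : Fin n | P i }, elements compared by their underlying
-- column / position only (so that a bijection of these setoids is a
-- bijection of the underlying finite sets)
SubsetSetoid : ∀ {n} → (Fin n → Set) → Setoid _ _
SubsetSetoid {n} P = On.setoid {B = Σ (Fin n) P} (setoid (Fin n)) proj₁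

module Submission where

-- Let s be the label of column c. The dot of c is placed at step s with maximal height, and a
-- ribbon drawn at a later step j (from column pos j to the column of label j − 1) can affect c
-- only when pos j < c. If s is a LR-maximum no larger label lies left of c, so the column is
-- frozen after step s: the dot keeps maximal height, and the left border, D in the basement,
-- could only have become U through a ribbon ending at c, drawn at step s + 1 from a column left
-- of c. Otherwise take the first label j > s placed left of c. If j = s + 1, the ribbon of step j
-- ends at c and turns its left border into U for good. If not, label j − 1 lies right of c, so
-- this ribbon passes over c and adds a box below its dot, which is then never maximal again.

open import Defs
open import Data.Nat using (ℕ)
open import Data.Fin.Permutation using (Permutation′)
open import Function.Bundles using (Bijection)

open import Data.Nat using (zero; suc; _+_; _*_; _∸_; _<ᵇ_; _≡ᵇ_; ⌊_/2⌋; _≤_; _<_; s≤s; s<s; z≤n; z<s)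
open import Data.Nat.Properties
open import Data.Bool using (true; false)
open import Data.Bool.Properties using (∧-zeroʳ)
open import Data.List using (List; []; _∷_; foldl; map; allFin; tabulate)
open import Data.List.Properties using (map-tabulate)
open import Data.Maybe using (Maybe; just; nothing)
open import Data.Product using (_×_; _,_; proj₁; proj₂; ∃-syntax; uncurry)
open import Data.Sum using (inj₁; inj₂)
open import Data.Fin using (Fin; toℕ) renaming (_<_ to _<ᶠ_)
import Data.Fin as Fin
import Data.Fin.Properties as Fin
open import Data.Fin.Permutation using (_⟨$⟩ʳ_; _⟨$⟩ˡ_; inverseˡ; inverseʳ)
open import Function.Base using (id; _∘_)
open import Function.Bundles using (_⇔_; mk⇔; Equivalence)
open import Function.Construct.Composition using (_⇔-∘_)
open import Function.Construct.Symmetry using (⇔-sym)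
open import Relation.Nullary using (¬_; yes; no; contradiction)
open import Relation.Nullary.Decidable using (dec-true; dec-false)
open import Relation.Unary using (Pred; Decidable)
open import Relation.Binary using (tri<; tri≈; tri>)
open import Relation.Binary.PropositionalEquality

<ᵇ-true : ∀ {m n} → m < n → (m <ᵇ n) ≡ true
<ᵇ-true = dec-true (_ <? _)

<ᵇ-false : ∀ {m n} → ¬ m < n → (m <ᵇ n) ≡ false
<ᵇ-false = dec-false (_ <? _)

≡ᵇ-refl : ∀ n → (n ≡ᵇ n) ≡ true
≡ᵇ-refl n = dec-true (n ≟ n) refl

≡ᵇ-false : ∀ {m n} → m ≢ n → (m ≡ᵇ n) ≡ false
≡ᵇ-false = dec-false (_ ≟ _)

1+2m<2n : ∀ {m n} → m < n → suc (2 * m) < 2 * n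
1+2m<2n {m} {n} m<n = subst (_≤ 2 * n) (*-suc 2 m) (*-monoʳ-≤ 2 m<n)

<⇒m∸1<m : ∀ {n m} → n < m → m ∸ 1 < m
<⇒m∸1<m (s≤s _) = n<1+n _

first-crossing : ∀ {p} {P : Pred ℕ p} → Decidable P → ∀ {m t} → m ≤ t → ¬ P m → P t →
                 ∃[ j ] m ≤ j × j < t × ¬ P j × P (suc j)
first-crossing P? {t = zero} z≤n ¬Pm Pt = contradiction Pt ¬Pm
first-crossing P? {t = suc t} m≤1+t ¬Pm Pt with m≤n⇒m<n∨m≡n m≤1+t
... | inj₂ refl = contradiction Pt ¬Pm
... | inj₁ m<1+t with P? t
...   | no ¬Pt = t , ≤-pred m<1+t , n<1+n t , ¬Pt , Pt
...   | yes Pt′ =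
        let j , m≤j , j<t , ¬Pj , P1+j = first-crossing P? (≤-pred m<1+t) ¬Pm Pt′
        in j , m≤j , m<n⇒m<1+n j<t , ¬Pj , P1+j

leftDepth rightDepth : Tableau → ℕ → ℕ
leftDepth T c = depth T (2 * c)
rightDepth T c = depth T (suc (2 * c))

leftBorder≡D⇒< : ∀ T c → leftBorder T c ≡ D → leftDepth T c < rightDepth T c
leftBorder≡D⇒< T c with leftDepth T c <ᵇ rightDepth T c | <ᵇ⇒< (leftDepth T c) (rightDepth T c)
... | true  | l<r = λ _ → l<r _
... | false | _   = λ ()

<⇒leftBorder≡D : ∀ T c → leftDepth T c < rightDepth T c → leftBorder T c ≡ D
<⇒leftBorder≡D T c l<r rewrite <ᵇ-true l<r = refl

basement-leftDepth : ∀ c → leftDepth basement c ≡ 0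
basement-leftDepth zero    = refl
basement-leftDepth (suc c) = subst (λ k → depth basement k ≡ 0) (sym (*-suc 2 c)) (basement-leftDepth c)

basement-rightDepth : ∀ c → rightDepth basement c ≡ 1
basement-rightDepth zero    = refl
basement-rightDepth (suc c) = subst (λ k → depth basement (suc k) ≡ 1) (sym (*-suc 2 c)) (basement-rightDepth c)

module _ {a b : ℕ} (T : Tableau) where

  ribbon-inside : ∀ {k} → suc (2 * a) < k → k < suc (2 * b) → depth (ribbon a b T) k ≡ depth T k + 2
  ribbon-inside p q rewrite <ᵇ-true p | <ᵇ-true q = refl

  ribbon-outsideˡ : ∀ {k} → k ≤ suc (2 * a) → depth (ribbon a b T) k ≡ depth T k
  ribbon-outsideˡ p rewrite <ᵇ-false (≤⇒≯ p) = refl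

  ribbon-outsideʳ : ∀ {k} → suc (2 * b) ≤ k → depth (ribbon a b T) k ≡ depth T k
  ribbon-outsideʳ {k} q rewrite <ᵇ-false (≤⇒≯ q) | ∧-zeroʳ (suc (2 * a) <ᵇ k) = refl

  ribbon-column-leftOf : ∀ {c} → c ≤ a →
    leftDepth (ribbon a b T) c ≡ leftDepth T c × rightDepth (ribbon a b T) c ≡ rightDepth T c
  ribbon-column-leftOf c≤a =
    ribbon-outsideˡ (m≤n⇒m≤1+n (*-monoʳ-≤ 2 c≤a)) , ribbon-outsideˡ (s≤s (*-monoʳ-≤ 2 c≤a))

  ribbon-column-rightOf : ∀ {c} → b < c →
    leftDepth (ribbon a b T) c ≡ leftDepth T c × rightDepth (ribbon a b T) c ≡ rightDepth T c
  ribbon-column-rightOf b<c =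
    ribbon-outsideʳ (<⇒≤ (1+2m<2n b<c)) , ribbon-outsideʳ (s≤s (*-monoʳ-≤ 2 (<⇒≤ b<c)))

  ribbon-column-inside : ∀ {c} → a < c → c < b →
    leftDepth (ribbon a b T) c ≡ leftDepth T c + 2 × rightDepth (ribbon a b T) c ≡ rightDepth T c + 2
  ribbon-column-inside a<c c<b =
    ribbon-inside (1+2m<2n a<c) (s≤s (*-monoʳ-≤ 2 (<⇒≤ c<b))) ,
    ribbon-inside (m<n⇒m<1+n (1+2m<2n a<c)) (s<s (*-monoʳ-< 2 c<b))

ribbon-column-end : ∀ {a c} (T : Tableau) → a < c →
  leftDepth (ribbon a c T) c ≡ leftDepth T c + 2 × rightDepth (ribbon a c T) c ≡ rightDepth T c
ribbon-column-end {a} {c} T a<c =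
  ribbon-inside {a} {c} T (1+2m<2n a<c) (n<1+n _) , ribbon-outsideʳ {a} {c} T ≤-refl

module Construction (pos : ℕ → ℕ) where

  previous : ℕ → Maybe ℕ
  previous zero    = nothing
  previous (suc j) = just (pos j)

  stepAt : ℕ → Tableau → Tableau
  stepAt j T = proj₁ (step (T , previous j) (pos j))

  step-previous : ∀ j T → step (T , previous j) (pos j) ≡ (stepAt j T , previous (suc j))
  step-previous zero    T = refl
  step-previous (suc j) T = refl

  stage : ℕ → Tableau
  stage zero    = basement
  stage (suc j) = stepAt j (stage j)

  positionsFrom : ℕ → ℕ → List ℕ
  positionsFrom k zero    = []
  positionsFrom k (suc r) = pos k ∷ positionsFrom (suc k) r

  foldl-positionsFrom : ∀ k r →
    foldl step (stage k , previous k) (positionsFrom k r) ≡ (stage (k + r) , previous (k + r))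
  foldl-positionsFrom k zero    rewrite +-identityʳ k = refl
  foldl-positionsFrom k (suc r) rewrite step-previous k (stage k) | +-suc k r =
    foldl-positionsFrom (suc k) r

  tabulate-positionsFrom : ∀ {m} (f : Fin m → ℕ) k → (∀ x → f x ≡ pos (k + toℕ x)) →
                           tabulate f ≡ positionsFrom k m
  tabulate-positionsFrom {zero}  f k f≗ = refl
  tabulate-positionsFrom {suc m} f k f≗ =
    cong₂ _∷_ (trans (f≗ Fin.zero) (cong pos (+-identityʳ k)))
              (tabulate-positionsFrom (f ∘ Fin.suc) (suc k)
                 (λ x → trans (f≗ (Fin.suc x)) (cong pos (+-suc k (toℕ x)))))

  stage-induction : ∀ {p} (P : Tableau → Set p) {k m} → k ≤ m →
    (∀ {j} → k ≤ j → j < m → P (stage j) → P (stage (suc j))) → P (stage k) → P (stage m)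
  stage-induction P {m = zero} z≤n preserve Pk = Pk
  stage-induction P {m = suc m} k≤1+m preserve Pk with m≤n⇒m<n∨m≡n k≤1+m
  ... | inj₂ refl   = Pk
  ... | inj₁ k<1+m  = preserve (≤-pred k<1+m) (n<1+n m)
    (stage-induction P (≤-pred k<1+m) (λ k≤j j<m → preserve k≤j (m<n⇒m<1+n j<m)) Pk)

  stepAt-ribbon : ∀ {j T} → pos (suc j) < pos j →
    stepAt (suc j) T ≡ ribbon (pos (suc j)) (pos j) (insertDot (pos (suc j)) T)
  stepAt-ribbon lt rewrite <ᵇ-true lt = refl

  stepAt-noRibbon : ∀ {j T} → ¬ pos (suc j) < pos j → stepAt (suc j) T ≡ insertDot (pos (suc j)) T
  stepAt-noRibbon ¬lt rewrite <ᵇ-false ¬lt = refl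

  -- A ribbon pushes the lower border down by one box strictly between its end columns: columns
  -- strictly inside are raised by a box, and its right end column only gets its left vertex lowered.
  data ColumnStep (c j : ℕ) (T T′ : Tableau) : Set where
    untouched : leftDepth T′ c ≡ leftDepth T c → rightDepth T′ c ≡ rightDepth T c →
                ColumnStep c j T T′
    covered   : ∀ {j′} → j ≡ suc j′ → pos j < c → c < pos j′ →
                leftDepth T′ c ≡ leftDepth T c + 2 → rightDepth T′ c ≡ rightDepth T c + 2 →
                ColumnStep c j T T′
    rightEnd  : ∀ {j′} → j ≡ suc j′ → pos j < c → pos j′ ≡ c →
                leftDepth T′ c ≡ leftDepth T c + 2 → rightDepth T′ c ≡ rightDepth T c →
                ColumnStep c j T T′

  columnStep : ∀ c j T → ColumnStep c j T (stepAt j T)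
  columnStep c zero T = untouched refl refl
  columnStep c (suc j) T with pos (suc j) <? pos j
  ... | no ¬lt rewrite stepAt-noRibbon {T = T} ¬lt = untouched refl refl
  ... | yes lt rewrite stepAt-ribbon {T = T} lt with pos (suc j) <? c
  ...   | no ¬a<c = uncurry untouched (ribbon-column-leftOf {pos (suc j)} {pos j} T (≮⇒≥ ¬a<c))
  ...   | yes a<c with <-cmp c (pos j)
  ...     | tri< c<b _ _ = uncurry (covered refl a<c c<b) (ribbon-column-inside {pos (suc j)} {pos j} T a<c c<b)
  ...     | tri≈ _ refl _ = uncurry (rightEnd refl a<c refl) (ribbon-column-end T a<c)
  ...     | tri> _ _ b<c = uncurry untouched (ribbon-column-rightOf {pos (suc j)} {pos j} T b<c)

  stepAt-covered : ∀ {c j T} → pos (suc j) < c → c < pos j →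
    rightDepth (stepAt (suc j) T) c ≡ rightDepth T c + 2
  stepAt-covered {c} {j} {T} a<c c<b rewrite stepAt-ribbon {T = T} (<-trans a<c c<b) =
    proj₂ (ribbon-column-inside {pos (suc j)} {pos j} T a<c c<b)

  stepAt-rightEnd : ∀ {j T} → pos (suc j) < pos j →
    leftDepth (stepAt (suc j) T) (pos j) ≡ leftDepth T (pos j) + 2 ×
    rightDepth (stepAt (suc j) T) (pos j) ≡ rightDepth T (pos j)
  stepAt-rightEnd {j} {T} lt rewrite stepAt-ribbon {T = T} lt = ribbon-column-end T lt

  rightDepth-stepAt-mono : ∀ c j T → rightDepth T c ≤ rightDepth (stepAt j T) c
  rightDepth-stepAt-mono c j T with columnStep c j T
  ... | untouched _ eR         = ≤-reflexive (sym eR)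
  ... | covered _ _ _ _ eR     = subst (rightDepth T c ≤_) (sym eR) (m≤m+n _ 2)
  ... | rightEnd _ _ _ _ eR    = ≤-reflexive (sym eR)

  boxes-stepAt-mono : ∀ c j T → boxes T c ≤ boxes (stepAt j T) c
  boxes-stepAt-mono c j T = ⌊n/2⌋-mono (s≤s (rightDepth-stepAt-mono c j T))

  dotHeight-stepAt : ∀ j T → dotHeight (stepAt j T) ≡ dotHeight (insertDot (pos j) T)
  dotHeight-stepAt zero    T = refl
  dotHeight-stepAt (suc j) T with pos (suc j) <ᵇ pos j
  ... | true  = refl
  ... | false = refl

  dotHeight-stepAt-self : ∀ j T → dotHeight (stepAt j T) (pos j) ≡ boxes T (pos j) ∸ 1
  dotHeight-stepAt-self j T rewrite dotHeight-stepAt j T | ≡ᵇ-refl (pos j) = refl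

  dotHeight-stepAt-other : ∀ {c} j T → c ≢ pos j → dotHeight (stepAt j T) c ≡ dotHeight T c
  dotHeight-stepAt-other j T c≢p rewrite dotHeight-stepAt j T | ≡ᵇ-false c≢p = refl

  stepAt-MaxHeight : ∀ j T → MaxHeight (stepAt j T) (pos j)
  stepAt-MaxHeight j T with columnStep (pos j) j T
  ... | untouched _ eR = trans (dotHeight-stepAt-self j T) (cong (λ r → ⌊ suc r /2⌋ ∸ 1) (sym eR))
  ... | covered _ p<p _ _ _  = contradiction p<p (<-irrefl refl)
  ... | rightEnd _ p<p _ _ _ = contradiction p<p (<-irrefl refl)

  dotHeight<boxes-stepAt : ∀ c j T → dotHeight T c < boxes T c →
    dotHeight (stepAt j T) c < boxes (stepAt j T) c
  dotHeight<boxes-stepAt c j T d<b with c ≟ pos j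
  ... | yes refl rewrite dotHeight-stepAt-self j T = <-≤-trans (<⇒m∸1<m d<b) (boxes-stepAt-mono c j T)
  ... | no c≢p rewrite dotHeight-stepAt-other j T c≢p = <-≤-trans d<b (boxes-stepAt-mono c j T)

  dotHeight<boxes : ∀ j c → dotHeight (stage j) c < boxes (stage j) c
  dotHeight<boxes zero    c = subst (λ r → 0 < ⌊ suc r /2⌋) (sym (basement-rightDepth c)) (s≤s z≤n)
  dotHeight<boxes (suc j) c = dotHeight<boxes-stepAt c j (stage j) (dotHeight<boxes j c)

  rightDepth≤1+leftDepth-stepAt : ∀ c j T → rightDepth T c ≤ suc (leftDepth T c) →
    rightDepth (stepAt j T) c ≤ suc (leftDepth (stepAt j T) c)
  rightDepth≤1+leftDepth-stepAt c j T r≤1+l with columnStep c j T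
  ... | untouched eL eR      = subst₂ (λ r l → r ≤ suc l) (sym eR) (sym eL) r≤1+l
  ... | covered _ _ _ eL eR  = subst₂ (λ r l → r ≤ suc l) (sym eR) (sym eL) (+-monoˡ-≤ 2 r≤1+l)
  ... | rightEnd _ _ _ eL eR = subst₂ (λ r l → r ≤ suc l) (sym eR) (sym eL) (≤-trans r≤1+l (s≤s (m≤m+n _ 2)))

  rightDepth≤1+leftDepth : ∀ j c → rightDepth (stage j) c ≤ suc (leftDepth (stage j) c)
  rightDepth≤1+leftDepth zero    c =
    subst₂ (λ r l → r ≤ suc l) (sym (basement-rightDepth c)) (sym (basement-leftDepth c)) ≤-refl
  rightDepth≤1+leftDepth (suc j) c =
    rightDepth≤1+leftDepth-stepAt c j (stage j) (rightDepth≤1+leftDepth j c)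

  rightDepth≤leftDepth-stepAt : ∀ c j T → rightDepth T c ≤ leftDepth T c →
    rightDepth (stepAt j T) c ≤ leftDepth (stepAt j T) c
  rightDepth≤leftDepth-stepAt c j T r≤l with columnStep c j T
  ... | untouched eL eR      = subst₂ _≤_ (sym eR) (sym eL) r≤l
  ... | covered _ _ _ eL eR  = subst₂ _≤_ (sym eR) (sym eL) (+-monoˡ-≤ 2 r≤l)
  ... | rightEnd _ _ _ eL eR = subst₂ _≤_ (sym eR) (sym eL) (≤-trans r≤l (m≤m+n _ 2))

  module Column (n : ℕ) (pos-injective : ∀ {j j′} → j < n → j′ < n → pos j ≡ pos j′ → j ≡ j′)
                (s : ℕ) (s<n : s < n) where

    c : ℕ
    c = pos s

    c≢pos : ∀ {j} → j < n → j ≢ s → c ≢ pos j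
    c≢pos j<n j≢s c≡pos = j≢s (pos-injective j<n s<n (sym c≡pos))

    module _ (laterRight : ∀ {j} → s < j → j < n → c < pos j) where

      laterRight⇒MaxHeight : MaxHeight (stage n) c
      laterRight⇒MaxHeight = stage-induction (λ T → MaxHeight T c) s<n preserve (stepAt-MaxHeight s (stage s))
        where
        preserve : ∀ {j} → suc s ≤ j → j < n → MaxHeight (stage j) c → MaxHeight (stage (suc j)) c
        preserve {j} s<j j<n max with columnStep c j (stage j)
        ... | untouched _ eR =
              trans (dotHeight-stepAt-other j (stage j) (c≢pos j<n (>⇒≢ s<j)))
                    (trans max (cong (λ r → ⌊ suc r /2⌋ ∸ 1) (sym eR)))
        ... | covered _ p<c _ _ _  = contradiction (laterRight s<j j<n) (<⇒≯ p<c)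
        ... | rightEnd _ p<c _ _ _ = contradiction (laterRight s<j j<n) (<⇒≯ p<c)

      laterRight⇒leftBorder≡D : leftBorder (stage n) c ≡ D
      laterRight⇒leftBorder≡D = <⇒leftBorder≡D (stage n) c
        (stage-induction (λ T → leftDepth T c < rightDepth T c) z≤n preserve
          (subst₂ _<_ (sym (basement-leftDepth c)) (sym (basement-rightDepth c)) (s≤s z≤n)))
        where
        preserve : ∀ {j} → 0 ≤ j → j < n → leftDepth (stage j) c < rightDepth (stage j) c →
                   leftDepth (stage (suc j)) c < rightDepth (stage (suc j)) c
        preserve {j} _ j<n l<r with columnStep c j (stage j)
        ... | untouched eL eR     = subst₂ _<_ (sym eL) (sym eR) l<r
        ... | covered _ _ _ eL eR = subst₂ _<_ (sym eL) (sym eR) (+-monoˡ-< 2 l<r)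
        ... | rightEnd {j′} refl p<c p′≡c _ _ =
              contradiction (laterRight s<j j<n) (<⇒≯ p<c)
          where
          s<j : s < suc j′
          s<j = s≤s (≤-reflexive (pos-injective s<n (<-trans (n<1+n j′) j<n) (sym p′≡c)))

    rightEnd⇒leftBorder≢D : suc s < n → pos (suc s) < c → ¬ leftBorder (stage n) c ≡ D
    rightEnd⇒leftBorder≢D 1+s<n p<c border =
      <⇒≱ (leftBorder≡D⇒< (stage n) c border)
        (stage-induction (λ T → rightDepth T c ≤ leftDepth T c) 1+s<n
          (λ {j} _ _ → rightDepth≤leftDepth-stepAt c j (stage j)) afterRightEnd)
      where
      afterRightEnd : rightDepth (stage (suc (suc s))) c ≤ leftDepth (stage (suc (suc s))) c
      afterRightEnd with stepAt-rightEnd {s} {stage (suc s)} p<c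
      ... | eL , eR = subst₂ _≤_ (sym eR) (sym eL)
        (≤-trans (rightDepth≤1+leftDepth (suc s) c) (m<m+n _ z<s))

    covered⇒¬MaxHeight : ∀ {j} → s < j → suc j < n → pos (suc j) < c → c < pos j →
                            ¬ MaxHeight (stage n) c
    covered⇒¬MaxHeight {j} s<j 1+j<n p<c c<p max =
      <-irrefl max (stage-induction (λ T → dotHeight T c < boxes T c ∸ 1) 1+j<n preserve afterCover)
      where
      boxes-covered : boxes (stage (suc (suc j))) c ≡ suc (boxes (stage (suc j)) c)
      boxes-covered = cong (λ r → ⌊ suc r /2⌋)
        (trans (stepAt-covered {T = stage (suc j)} p<c c<p) (+-comm _ 2))
      afterCover : dotHeight (stage (suc (suc j))) c < boxes (stage (suc (suc j))) c ∸ 1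
      afterCover = subst₂ _<_
        (sym (dotHeight-stepAt-other (suc j) (stage (suc j)) (>⇒≢ p<c)))
        (cong (_∸ 1) (sym boxes-covered))
        (dotHeight<boxes (suc j) c)
      preserve : ∀ {i} → suc (suc j) ≤ i → i < n → dotHeight (stage i) c < boxes (stage i) c ∸ 1 →
                 dotHeight (stage (suc i)) c < boxes (stage (suc i)) c ∸ 1
      preserve {i} 2+j≤i i<n d<m
        rewrite dotHeight-stepAt-other i (stage i) (c≢pos i<n (>⇒≢ (<-trans s<j (≤-trans (n≤1+n _) 2+j≤i)))) =
        <-≤-trans d<m (∸-monoˡ-≤ 1 (boxes-stepAt-mono c i (stage i)))

    laterLeft⇒¬MaxHeightLeftD : ∀ {t} → s < t → t < n → pos t < c →
                            ¬ (MaxHeight (stage n) c × leftBorder (stage n) c ≡ D)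
    laterLeft⇒¬MaxHeightLeftD {t} s<t t<n pt<c (max , border) with pos (suc s) <? c
    ... | yes p<c = rightEnd⇒leftBorder≢D (≤-<-trans s<t t<n) p<c border
    ... | no ¬p<c =
      let j , 1+s≤j , j<t , ¬pj<c , p<c = first-crossing (λ j → pos j <? c) s<t ¬p<c pt<c
          c<p = ≤∧≢⇒< (≮⇒≥ ¬pj<c) (c≢pos (<-trans j<t t<n) (>⇒≢ 1+s≤j))
      in covered⇒¬MaxHeight 1+s≤j (≤-<-trans j<t t<n) p<c c<p max

module _ {n} (σ : Permutation′ n) where

  LargerLabelsRight : Fin n → Set
  LargerLabelsRight i = ∀ j → σ ⟨$⟩ʳ i <ᶠ j → i <ᶠ σ ⟨$⟩ˡ j

  ⟨$⟩ʳ-injective : ∀ {i j} → σ ⟨$⟩ʳ i ≡ σ ⟨$⟩ʳ j → i ≡ j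
  ⟨$⟩ʳ-injective eq = trans (sym (inverseˡ σ)) (trans (cong (σ ⟨$⟩ˡ_) eq) (inverseˡ σ))

  ⟨$⟩ˡ-injective : ∀ {i j} → σ ⟨$⟩ˡ i ≡ σ ⟨$⟩ˡ j → i ≡ j
  ⟨$⟩ˡ-injective eq = trans (sym (inverseʳ σ)) (trans (cong (σ ⟨$⟩ʳ_) eq) (inverseʳ σ))

  LRMax⇔largerLabelsRight : ∀ i → LRMax σ i ⇔ LargerLabelsRight i
  LRMax⇔largerLabelsRight i = mk⇔ to from
    where
    to : LRMax σ i → LargerLabelsRight i
    to lrMax j σi<j with Fin.<-cmp (σ ⟨$⟩ˡ j) i
    ... | tri< σ⁻¹j<i _ _ = contradiction (subst (_<ᶠ σ ⟨$⟩ʳ i) (inverseʳ σ) (lrMax _ σ⁻¹j<i)) (Fin.<-asym σi<j)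
    ... | tri≈ _ σ⁻¹j≡i _ = contradiction (trans (sym (inverseʳ σ)) (cong (σ ⟨$⟩ʳ_) σ⁻¹j≡i))
                                          (Fin.<⇒≢ σi<j ∘ sym)
    ... | tri> _ _ i<σ⁻¹j = i<σ⁻¹j
    from : LargerLabelsRight i → LRMax σ i
    from right i′ i′<i with Fin.<-cmp (σ ⟨$⟩ʳ i′) (σ ⟨$⟩ʳ i)
    ... | tri< lt _ _ = lt
    ... | tri≈ _ eq _ = contradiction (⟨$⟩ʳ-injective eq) (Fin.<⇒≢ i′<i)
    ... | tri> _ _ gt = contradiction (subst (i <ᶠ_) (inverseˡ σ) (right _ gt)) (Fin.<-asym i′<i)

  pos : ℕ → ℕ
  pos j with j <? n
  ... | yes j<n = position σ (Fin.fromℕ< j<n)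
  ... | no _    = 0

  pos-fromℕ< : ∀ {j} (j<n : j < n) → pos j ≡ position σ (Fin.fromℕ< j<n)
  pos-fromℕ< {j} j<n with j <? n
  ... | yes _  = refl
  ... | no j≮n = contradiction j<n j≮n

  pos-toℕ : ∀ x → pos (toℕ x) ≡ position σ x
  pos-toℕ x = trans (pos-fromℕ< (Fin.toℕ<n x)) (cong (position σ) (Fin.fromℕ<-toℕ x _))

  pos-injective : ∀ {j j′} → j < n → j′ < n → pos j ≡ pos j′ → j ≡ j′
  pos-injective {j} {j′} j<n j′<n eq = Fin.fromℕ<-injective j j′ j<n j′<n
    (⟨$⟩ˡ-injective (Fin.toℕ-injective (trans (sym (pos-fromℕ< j<n)) (trans eq (pos-fromℕ< j′<n)))))

  open Construction pos

  tableau≡stage : tableau σ ≡ stage n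
  tableau≡stage = cong proj₁ (begin
    foldl step (basement , nothing) (map (position σ) (allFin n))
      ≡⟨ cong (foldl step (basement , nothing)) positions ⟩
    foldl step (stage 0 , previous 0) (positionsFrom 0 n)
      ≡⟨ foldl-positionsFrom 0 n ⟩
    (stage n , previous n)
      ∎)
    where
    open ≡-Reasoning
    positions : map (position σ) (allFin n) ≡ positionsFrom 0 n
    positions = trans (map-tabulate id (position σ)) (tabulate-positionsFrom (position σ) 0 (sym ∘ pos-toℕ))

  MaxHeightLeftD⇔largerLabelsRight : ∀ i → MaxHeightLeftD (tableau σ) i ⇔ LargerLabelsRight i
  MaxHeightLeftD⇔largerLabelsRight i = mk⇔ to from
    where
    s : ℕ
    s = toℕ (σ ⟨$⟩ʳ i)
    open Column n pos-injective s (Fin.toℕ<n _)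

    pos-s : pos s ≡ toℕ i
    pos-s = trans (pos-toℕ _) (cong toℕ (inverseˡ σ))

    atStage : MaxHeightLeftD (tableau σ) i ≡ (MaxHeight (stage n) c × leftBorder (stage n) c ≡ D)
    atStage = cong₂ (λ T c → MaxHeight T c × leftBorder T c ≡ D) tableau≡stage (sym pos-s)

    to : MaxHeightLeftD (tableau σ) i → LargerLabelsRight i
    to maxD j σi<j with Fin.<-cmp i (σ ⟨$⟩ˡ j)
    ... | tri< i<σ⁻¹j _ _ = i<σ⁻¹j
    ... | tri≈ _ i≡σ⁻¹j _ = contradiction (trans (cong (σ ⟨$⟩ʳ_) i≡σ⁻¹j) (inverseʳ σ)) (Fin.<⇒≢ σi<j)
    ... | tri> _ _ σ⁻¹j<i = contradiction (subst id atStage maxD)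
          (laterLeft⇒¬MaxHeightLeftD σi<j (Fin.toℕ<n j) (subst₂ _<_ (sym (pos-toℕ j)) (sym pos-s) σ⁻¹j<i))

    from : LargerLabelsRight i → MaxHeightLeftD (tableau σ) i
    from right = subst id (sym atStage) (laterRight⇒MaxHeight laterRight , laterRight⇒leftBorder≡D laterRight)
      where
      laterRight : ∀ {j} → s < j → j < n → c < pos j
      laterRight {j} s<j j<n = subst₂ _<_ (sym pos-s) (sym (pos-fromℕ< j<n))
        (right (Fin.fromℕ< j<n) (subst (s <_) (sym (Fin.toℕ-fromℕ< j<n)) s<j))

SubsetSetoid-bijection : ∀ {n} {P Q : Fin n → Set} → (∀ i → P i ⇔ Q i) →
                         Bijection (SubsetSetoid P) (SubsetSetoid Q)
SubsetSetoid-bijection P⇔Q = record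
  { to        = λ (i , p) → i , Equivalence.to (P⇔Q i) p
  ; cong      = id
  ; bijective = id , λ (i , q) → (i , Equivalence.from (P⇔Q i) q) , id
  }

proposition13 : ∀ (n : ℕ) (σ : Permutation′ n) →
    Bijection (SubsetSetoid {n} (LRMax σ))
    (SubsetSetoid (MaxHeightLeftD (tableau σ) {n}))
proposition13 n σ = SubsetSetoid-bijection λ i →
  ⇔-sym (MaxHeightLeftD⇔largerLabelsRight σ i) ⇔-∘ LRMax⇔largerLabelsRight σ i
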